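{- There is a sequence of valid modal implications $(\phi_n\to\psi_n)_{n=1,2,\dots}$ such that (1) $|\phi_n|$ and $|\psi_n|$ are bounded by a polynomial in $n$, and (2) every Craig interpolant $\vartheta$ for $\phi_n\to\psi_n$ (a modal formula with $\models\phi_n\to\vartheta$, $\models\vartheta\to\psi_n$ and $\mathrm{sig}(\vartheta)\subseteq\mathrm{sig}(\phi_n)\cap\mathrm{sig}(\psi_n)$) has DAG-size $|\vartheta|_{\mathrm{DAG}}\ge 2^n$.
   Context: Modal formulas are built from proposition letters, $\top,\bot,\neg,\land,\lor,\Diamond,\Box$; $\models$ is validity over all Kripke models (logic $\mathsf K$); $\mathrm{sig}(\chi)$ is the set of proposition letters in $\chi$. $|\chi|$ is the length of $\chi$ (number of symbols when written as a string), and $|\chi|_{\mathrm{DAG}}$ is the number of distinct subformulas of $\chi$. -}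

module Defs where

open import Data.Nat using (ℕ; zero; suc; _+_; _*_; _^_; _≤_)
import Data.Nat.Properties as ℕP
open import Data.List using (List; []; _∷_; _++_; length; deduplicate)
open import Data.Product using (Σ; _×_; _,_)
open import Data.Sum using (_⊎_)
open import Data.Unit using (⊤)
open import Data.Empty using (⊥)
open import Relation.Nullary using (¬_; Dec; yes; no)
open import Relation.Binary.PropositionalEquality using (_≡_; refl; cong; cong₂)
open import Relation.Binary.Definitions using (DecidableEquality)

data Form : Set where
  var  : ℕ → Form
  ⊤f ⊥f : Form
  ¬f_  : Form → Form
  _∧f_ _∨f_ : Form → Form → Form
  ◇_ □_ : Form → Form

_⇒f_ : Form → Form → Form
φ ⇒f ψ = (¬f φ) ∨f ψ

record Model : Set₁ where
  field
    W : Set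
    R : W → W → Set
    V : ℕ → W → Set
open Model public

_,_⊨_ : (M : Model) → W M → Form → Set
M , w ⊨ var p   = V M p w
M , w ⊨ ⊤f      = ⊤
M , w ⊨ ⊥f      = ⊥
M , w ⊨ (¬f φ)  = ¬ (M , w ⊨ φ)
M , w ⊨ (φ ∧f ψ) = (M , w ⊨ φ) × (M , w ⊨ ψ)
M , w ⊨ (φ ∨f ψ) = (M , w ⊨ φ) ⊎ (M , w ⊨ ψ)
M , w ⊨ (◇ φ)   = Σ (W M) λ v → R M w v × (M , v ⊨ φ)
M , w ⊨ (□ φ)   = ∀ v → R M w v → M , v ⊨ φ

⊨_ : Form → Set₁
⊨ φ = (M : Model) (w : W M) → M , w ⊨ φ

Occurs : ℕ → Form → Set
Occurs p (var q)  = p ≡ q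
Occurs p ⊤f       = ⊥
Occurs p ⊥f       = ⊥
Occurs p (¬f φ)   = Occurs p φ
Occurs p (φ ∧f ψ) = Occurs p φ ⊎ Occurs p ψ
Occurs p (φ ∨f ψ) = Occurs p φ ⊎ Occurs p ψ
Occurs p (◇ φ)    = Occurs p φ
Occurs p (□ φ)    = Occurs p φ

-- Length as a string: each letter/constant/unary operator is one symbol,
-- binary formulas are written (φ ∘ ψ), contributing 3 symbols.
len : Form → ℕ
len (var _)  = 1
len ⊤f       = 1
len ⊥f       = 1
len (¬f φ)   = suc (len φ)
len (φ ∧f ψ) = 3 + len φ + len ψ
len (φ ∨f ψ) = 3 + len φ + len ψ
len (◇ φ)    = suc (len φ)
len (□ φ)    = suc (len φ)

_≟f_ : DecidableEquality Form
var p ≟f var q with p ℕP.≟ q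
... | yes refl = yes refl
... | no ne = no λ { refl → ne refl }
var _ ≟f ⊤f = no λ ()
var _ ≟f ⊥f = no λ ()
var _ ≟f (¬f _) = no λ ()
var _ ≟f (_ ∧f _) = no λ ()
var _ ≟f (_ ∨f _) = no λ ()
var _ ≟f (◇ _) = no λ ()
var _ ≟f (□ _) = no λ ()
⊤f ≟f var _ = no λ ()
⊤f ≟f ⊤f = yes refl
⊤f ≟f ⊥f = no λ ()
⊤f ≟f (¬f _) = no λ ()
⊤f ≟f (_ ∧f _) = no λ ()
⊤f ≟f (_ ∨f _) = no λ ()
⊤f ≟f (◇ _) = no λ ()
⊤f ≟f (□ _) = no λ ()
⊥f ≟f var _ = no λ ()
⊥f ≟f ⊤f = no λ ()
⊥f ≟f ⊥f = yes refl
⊥f ≟f (¬f _) = no λ ()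
⊥f ≟f (_ ∧f _) = no λ ()
⊥f ≟f (_ ∨f _) = no λ ()
⊥f ≟f (◇ _) = no λ ()
⊥f ≟f (□ _) = no λ ()
(¬f φ) ≟f (¬f ψ) with φ ≟f ψ
... | yes refl = yes refl
... | no ne = no λ { refl → ne refl }
(¬f _) ≟f var _ = no λ ()
(¬f _) ≟f ⊤f = no λ ()
(¬f _) ≟f ⊥f = no λ ()
(¬f _) ≟f (_ ∧f _) = no λ ()
(¬f _) ≟f (_ ∨f _) = no λ ()
(¬f _) ≟f (◇ _) = no λ ()
(¬f _) ≟f (□ _) = no λ ()
(φ₁ ∧f φ₂) ≟f (ψ₁ ∧f ψ₂) with φ₁ ≟f ψ₁ | φ₂ ≟f ψ₂
... | yes refl | yes refl = yes refl
... | no ne | _ = no λ { refl → ne refl }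
... | _ | no ne = no λ { refl → ne refl }
(_ ∧f _) ≟f var _ = no λ ()
(_ ∧f _) ≟f ⊤f = no λ ()
(_ ∧f _) ≟f ⊥f = no λ ()
(_ ∧f _) ≟f (¬f _) = no λ ()
(_ ∧f _) ≟f (_ ∨f _) = no λ ()
(_ ∧f _) ≟f (◇ _) = no λ ()
(_ ∧f _) ≟f (□ _) = no λ ()
(φ₁ ∨f φ₂) ≟f (ψ₁ ∨f ψ₂) with φ₁ ≟f ψ₁ | φ₂ ≟f ψ₂
... | yes refl | yes refl = yes refl
... | no ne | _ = no λ { refl → ne refl }
... | _ | no ne = no λ { refl → ne refl }
(_ ∨f _) ≟f var _ = no λ ()
(_ ∨f _) ≟f ⊤f = no λ ()
(_ ∨f _) ≟f ⊥f = no λ ()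
(_ ∨f _) ≟f (¬f _) = no λ ()
(_ ∨f _) ≟f (_ ∧f _) = no λ ()
(_ ∨f _) ≟f (◇ _) = no λ ()
(_ ∨f _) ≟f (□ _) = no λ ()
(◇ φ) ≟f (◇ ψ) with φ ≟f ψ
... | yes refl = yes refl
... | no ne = no λ { refl → ne refl }
(◇ _) ≟f var _ = no λ ()
(◇ _) ≟f ⊤f = no λ ()
(◇ _) ≟f ⊥f = no λ ()
(◇ _) ≟f (¬f _) = no λ ()
(◇ _) ≟f (_ ∧f _) = no λ ()
(◇ _) ≟f (_ ∨f _) = no λ ()
(◇ _) ≟f (□ _) = no λ ()
(□ φ) ≟f (□ ψ) with φ ≟f ψ
... | yes refl = yes refl
... | no ne = no λ { refl → ne refl }
(□ _) ≟f var _ = no λ ()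
(□ _) ≟f ⊤f = no λ ()
(□ _) ≟f ⊥f = no λ ()
(□ _) ≟f (¬f _) = no λ ()
(□ _) ≟f (_ ∧f _) = no λ ()
(□ _) ≟f (_ ∨f _) = no λ ()
(□ _) ≟f (◇ _) = no λ ()

subs : Form → List Form
subs (var p)  = var p ∷ []
subs ⊤f       = ⊤f ∷ []
subs ⊥f       = ⊥f ∷ []
subs (¬f φ)   = (¬f φ) ∷ subs φ
subs (φ ∧f ψ) = (φ ∧f ψ) ∷ subs φ ++ subs ψ
subs (φ ∨f ψ) = (φ ∨f ψ) ∷ subs φ ++ subs ψ
subs (◇ φ)    = (◇ φ) ∷ subs φ
subs (□ φ)    = (□ φ) ∷ subs φ

dagSize : Form → ℕ
dagSize χ = length (deduplicate _≟f_ (subs χ))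

Interpolant : Form → Form → Form → Set₁
Interpolant φ ψ ϑ =
  (⊨ (φ ⇒f ϑ)) × (⊨ (ϑ ⇒f ψ)) ×
  (∀ p → Occurs p ϑ → Occurs p φ × Occurs p ψ)

PolyBounded : (ℕ → ℕ) → Set
PolyBounded f = Σ ℕ λ c → Σ ℕ λ k → ∀ n → 1 ≤ n → f n ≤ c * n ^ k

{-# OPTIONS --safe #-}
-- Let rᵢ, pᵢ, qᵢ (i < n) be letters. Φₙ says that r agrees with p here and at some world two
-- steps away, and that each pᵢ is rigid: it has the same value here and at every world two steps
-- away. Ξₙ says that r agrees with q here, that each qᵢ is rigid, and that r disagrees with q at
-- every world two steps away; Ψₙ = ¬ Ξₙ. If Φₙ and Ξₙ both held at w, then at the world v two
-- steps away where r = p we would get r(v) = p(v) = p(w) = r(w) = q(w) = q(v); so Φₙ → Ψₙ is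
-- valid, and an interpolant ϑ may only use the letters rᵢ.
--
-- For a set S of r-valuations (there are 2^(2^n) of them) and a valuation c, the world top(c,S)
-- has the single successor mid(S), whose successors are the leaf(d) with d ∈ S; r is c at
-- top(c,S), d at leaf(d) and false at mid(S), and p = q = c on the whole component. Then
-- top(c,S) satisfies Φₙ if c ∈ S and Ξₙ if c ∉ S, so ϑ holds there iff c ∈ S. The r-values at
-- top(c,S) do not depend on S, so the truth of the subformulas of ϑ at top(c,S) is determined by
-- their truth at mid(S), which does not depend on c since ϑ cannot see p and q. Hence different
-- sets S give mid(S) different truth tables on the distinct subformulas of ϑ, and
-- 2^(2^n) ≤ 2^(dagSize ϑ).
module Submission where

open import Defs
open import Level using (0ℓ)
open import Axiom.ExcludedMiddle using (ExcludedMiddle)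
open import Data.Nat using (ℕ; zero; suc; _+_; _*_; _^_; _≤_; _<_; s≤s; z≤n)
open import Data.Nat.Properties
  using (+-assoc; +-cancelʳ-≡; *-cancelʳ-≡; m≤m*n; +-monoʳ-≤; *-distribʳ-+; *-identityʳ;
         ^-monoʳ-<; m^n>0; ≮⇒≥; <⇒≱; module ≤-Reasoning)
open import Data.Nat.Tactic.RingSolver using (solve-∀)
open import Data.Fin using (Fin; zero; suc; toℕ; fromℕ<; finToFun; funToFin; combine)
open import Data.Fin.Properties using (toℕ-injective; finToFun-funToFin; funToFin-finToFin; injective⇒≤)
open import Data.Product using (Σ; ∃-syntax; _×_; _,_; proj₁; proj₂)
open import Data.Product.Function.NonDependent.Propositional using (_×-⇔_)
open import Data.Sum using (_⊎_; inj₁; inj₂)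
import Data.Sum as Sum
open import Data.Sum.Function.Propositional using (_⊎-⇔_)
open import Data.Unit using (tt)
open import Data.Empty using (⊥)
open import Data.List using (List; _++_; length; lookup; deduplicate)
open import Data.List.Membership.Propositional using (_∈_)
open import Data.List.Membership.Propositional.Properties using (∈-++⁺ˡ; ∈-++⁺ʳ; ∈-++⁻; ∈-deduplicate⁺)
open import Data.List.Relation.Unary.Any using (here; there; index)
open import Data.List.Relation.Unary.Any.Properties using (lookup-index)
open import Data.List.Relation.Binary.Subset.Propositional using (_⊆_)
open import Function using (_∘_; id)
open import Function.Bundles using (_⇔_; mk⇔; Equivalence)
import Function.Properties.Equivalence as ⇔
open import Function.Related.Propositional using (module EquationalReasoning)
open import Function.Related.TypeIsomorphisms using (¬-cong-⇔)
open import Relation.Nullary using (¬_; Dec; yes; no; contradiction)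
open import Relation.Nullary.Decidable using (decidable-stable)
open import Relation.Binary.PropositionalEquality
  using (_≡_; _≢_; _≗_; refl; sym; trans; cong; cong₂; subst; module ≡-Reasoning)

open Equivalence using (to; from)

^-cancelˡ-≤ : ∀ b {m n} → 1 < b → b ^ m ≤ b ^ n → m ≤ n
^-cancelˡ-≤ b 1<b bᵐ≤bⁿ = ≮⇒≥ λ n<m → <⇒≱ (^-monoʳ-< b 1<b n<m) bᵐ≤bⁿ

linear⇒PolyBounded : ∀ {f : ℕ → ℕ} a b → (∀ n → f n ≡ a * n + b) → PolyBounded f
linear⇒PolyBounded {f} a b f≡ = a + b , 1 , bound
  where
    open ≤-Reasoning
    bound : ∀ n → 1 ≤ n → f n ≤ (a + b) * n ^ 1
    bound n@(suc _) _ = begin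
      f n             ≡⟨ f≡ n ⟩
      a * n + b       ≤⟨ +-monoʳ-≤ (a * n) (m≤m*n b n) ⟩
      a * n + b * n   ≡⟨ *-distribʳ-+ n a b ⟨
      (a + b) * n     ≡⟨ cong ((a + b) *_) (*-identityʳ n) ⟨
      (a + b) * n ^ 1 ∎

funToFin-cong : ∀ {m k} {f g : Fin m → Fin k} → f ≗ g → funToFin f ≡ funToFin g
funToFin-cong {zero}  f≗g = refl
funToFin-cong {suc m} f≗g = cong₂ combine (f≗g zero) (funToFin-cong (f≗g ∘ suc))

funToFin-injective : ∀ {m k} {f g : Fin m → Fin k} → funToFin f ≡ funToFin g → f ≗ g
funToFin-injective {f = f} {g} eq i =
  trans (sym (finToFun-funToFin f i)) (trans (cong (λ c → finToFun c i) eq) (finToFun-funToFin g i))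

Bit : ∀ {m} → Fin (2 ^ m) → Fin m → Set
Bit {m} c i = finToFun {2} {m} c i ≡ suc zero

Bit-ext : ∀ {m} {c d : Fin (2 ^ m)} → (∀ (i : Fin m) → Bit c i ⇔ Bit d i) → c ≡ d
Bit-ext {m} {c} {d} c≈d = begin
  c                             ≡⟨ funToFin-finToFin {m} {2} c ⟨
  funToFin (finToFun {2} {m} c) ≡⟨ funToFin-cong (λ i → bit-ext (c≈d i)) ⟩
  funToFin (finToFun {2} {m} d) ≡⟨ funToFin-finToFin {m} {2} d ⟩
  d                             ∎
  where
    open ≡-Reasoning
    bit-ext : {x y : Fin 2} → (x ≡ suc zero) ⇔ (y ≡ suc zero) → x ≡ y
    bit-ext {zero}     {zero}     _ = refl
    bit-ext {zero}     {suc zero} e = from e refl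
    bit-ext {suc zero} {zero}     e = sym (to e refl)
    bit-ext {suc zero} {suc zero} _ = refl

decToBit : ∀ {A : Set} → Dec A → Fin 2
decToBit (yes _) = suc zero
decToBit (no _)  = zero

decToBit-≡⇒⇔ : ∀ {A B : Set} (a? : Dec A) (b? : Dec B) → decToBit a? ≡ decToBit b? → A ⇔ B
decToBit-≡⇒⇔ (yes a) (yes b) _ = mk⇔ (λ _ → b) (λ _ → a)
decToBit-≡⇒⇔ (no ¬a) (no ¬b) _ = mk⇔ (λ a → contradiction a ¬a) (λ b → contradiction b ¬b)

¬⊎⇒→ : ∀ {A B : Set} → ¬ A ⊎ B → A → B
¬⊎⇒→ (inj₁ ¬a) a = contradiction a ¬a
¬⊎⇒→ (inj₂ b)  _ = b

→⇒¬⊎ : ∀ {A B : Set} → Dec A → (A → B) → ¬ A ⊎ B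
→⇒¬⊎ (yes a) f = inj₂ (f a)
→⇒¬⊎ (no ¬a) _ = inj₁ ¬a

¬⊎×¬⊎⇔⇔ : ∀ {A B : Set} → Dec A → Dec B → ((¬ A ⊎ B) × (¬ B ⊎ A)) ⇔ (A ⇔ B)
¬⊎×¬⊎⇔⇔ a? b? = mk⇔ (λ (a⇒b , b⇒a) → mk⇔ (¬⊎⇒→ a⇒b) (¬⊎⇒→ b⇒a))
                    (λ a⇔b → →⇒¬⊎ a? (to a⇔b) , →⇒¬⊎ b? (from a⇔b))

_⇔f_ : Form → Form → Form
φ ⇔f ψ = (φ ⇒f ψ) ∧f (ψ ⇒f φ)

⋀ : ∀ {m} → (Fin m → Form) → Form
⋀ {zero}  f = ⊤f
⋀ {suc m} f = f zero ∧f ⋀ (f ∘ suc)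

rigid : Form → Form
rigid φ = (φ ⇒f (□ □ φ)) ∧f (φ ∨f (□ □ (¬f φ)))

module _ {M : Model} {w : W M} where

  ⊨⋀⁺ : ∀ {m} (f : Fin m → Form) → (∀ i → M , w ⊨ f i) → M , w ⊨ ⋀ f
  ⊨⋀⁺ {zero}  f _  = tt
  ⊨⋀⁺ {suc m} f ⊨f = ⊨f zero , ⊨⋀⁺ (f ∘ suc) (⊨f ∘ suc)

  ⊨⋀⁻ : ∀ {m} (f : Fin m → Form) → M , w ⊨ ⋀ f → ∀ i → M , w ⊨ f i
  ⊨⋀⁻ f (⊨f₀ , _)  zero    = ⊨f₀
  ⊨⋀⁻ f (_ , ⊨f₊) (suc i) = ⊨⋀⁻ (f ∘ suc) ⊨f₊ i

  ⊨rigid⁺ : ExcludedMiddle 0ℓ → ∀ φ → (∀ {u v} → R M w u → R M u v → (M , w ⊨ φ) ⇔ (M , v ⊨ φ)) →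
            M , w ⊨ rigid φ
  ⊨rigid⁺ lem φ same with lem {M , w ⊨ φ}
  ... | yes ⊨φ = inj₂ (λ u wu v uv → to (same wu uv) ⊨φ) , inj₁ ⊨φ
  ... | no ⊭φ  = inj₁ ⊭φ , inj₂ (λ u wu v uv → ⊭φ ∘ from (same wu uv))

  ⊨rigid⁻ : ∀ φ {u v} → M , w ⊨ rigid φ → R M w u → R M u v → (M , w ⊨ φ) ⇔ (M , v ⊨ φ)
  ⊨rigid⁻ φ {u} {v} (keep , restore) wu uv = mk⇔ (λ ⊨φ → ¬⊎⇒→ keep ⊨φ u wu v uv) (back restore)
    where
      back : M , w ⊨ φ ⊎ M , w ⊨ (□ □ (¬f φ)) → M , v ⊨ φ → M , w ⊨ φ
      back (inj₁ ⊨φ)   _   = ⊨φ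
      back (inj₂ □□¬φ) ⊨φv = contradiction ⊨φv (□□¬φ u wu v uv)

Occurs-⋀ : ∀ {m j} (f : Fin m → Form) → Occurs j (⋀ f) → ∃[ i ] Occurs j (f i)
Occurs-⋀ {suc m} f (inj₁ o) = zero , o
Occurs-⋀ {suc m} f (inj₂ o) with Occurs-⋀ (f ∘ suc) o
... | i , o' = suc i , o'

Occurs-rigid : ∀ {j} χ → Occurs j (rigid χ) → Occurs j χ
Occurs-rigid χ (inj₁ (inj₁ o)) = o
Occurs-rigid χ (inj₁ (inj₂ o)) = o
Occurs-rigid χ (inj₂ (inj₁ o)) = o
Occurs-rigid χ (inj₂ (inj₂ o)) = o

len-⋀ : ∀ {m} K (f : Fin m → Form) → (∀ i → len (f i) ≡ K) → len (⋀ f) ≡ m * (3 + K) + 1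
len-⋀ {zero}  K f _     = refl
len-⋀ {suc m} K f len-f rewrite len-f zero | len-⋀ K (f ∘ suc) (len-f ∘ suc) =
  cong (3 +_) (sym (+-assoc K (m * (3 + K)) 1))

subs-refl : ∀ χ → χ ∈ subs χ
subs-refl (var _)  = here refl
subs-refl ⊤f       = here refl
subs-refl ⊥f       = here refl
subs-refl (¬f _)   = here refl
subs-refl (_ ∧f _) = here refl
subs-refl (_ ∨f _) = here refl
subs-refl (◇ _)    = here refl
subs-refl (□ _)    = here refl

subs-⊆ : ∀ θ {χ} → χ ∈ subs θ → subs χ ⊆ subs θ
subs-⊆-++ : ∀ θ₁ θ₂ {χ} → χ ∈ subs θ₁ ++ subs θ₂ → subs χ ⊆ subs θ₁ ++ subs θ₂

subs-⊆ (var _)    (here refl) = id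
subs-⊆ ⊤f         (here refl) = id
subs-⊆ ⊥f         (here refl) = id
subs-⊆ (¬f _)     (here refl) = id
subs-⊆ (¬f θ)     (there χ∈)  = there ∘ subs-⊆ θ χ∈
subs-⊆ (_ ∧f _)   (here refl) = id
subs-⊆ (θ₁ ∧f θ₂) (there χ∈)  = there ∘ subs-⊆-++ θ₁ θ₂ χ∈
subs-⊆ (_ ∨f _)   (here refl) = id
subs-⊆ (θ₁ ∨f θ₂) (there χ∈)  = there ∘ subs-⊆-++ θ₁ θ₂ χ∈
subs-⊆ (◇ _)      (here refl) = id
subs-⊆ (◇ θ)      (there χ∈)  = there ∘ subs-⊆ θ χ∈
subs-⊆ (□ _)      (here refl) = id
subs-⊆ (□ θ)      (there χ∈)  = there ∘ subs-⊆ θ χ∈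

subs-⊆-++ θ₁ θ₂ χ∈ with ∈-++⁻ (subs θ₁) χ∈
... | inj₁ χ∈₁ = ∈-++⁺ˡ ∘ subs-⊆ θ₁ χ∈₁
... | inj₂ χ∈₂ = ∈-++⁺ʳ (subs θ₁) ∘ subs-⊆ θ₂ χ∈₂

var∈subs⇒Occurs : ∀ θ {j} → var j ∈ subs θ → Occurs j θ
var∈subs⇒Occurs (var _)    (here refl) = refl
var∈subs⇒Occurs ⊤f         (here ())
var∈subs⇒Occurs ⊥f         (here ())
var∈subs⇒Occurs (¬f θ)     (there v∈)  = var∈subs⇒Occurs θ v∈
var∈subs⇒Occurs (θ₁ ∧f θ₂) (there v∈)  =
  Sum.map (var∈subs⇒Occurs θ₁) (var∈subs⇒Occurs θ₂) (∈-++⁻ (subs θ₁) v∈)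
var∈subs⇒Occurs (θ₁ ∨f θ₂) (there v∈)  =
  Sum.map (var∈subs⇒Occurs θ₁) (var∈subs⇒Occurs θ₂) (∈-++⁻ (subs θ₁) v∈)
var∈subs⇒Occurs (◇ θ)      (there v∈)  = var∈subs⇒Occurs θ v∈
var∈subs⇒Occurs (□ θ)      (there v∈)  = var∈subs⇒Occurs θ v∈

Agree : (M : Model) → List Form → W M → W M → Set
Agree M L w w' = ∀ {χ} → χ ∈ L → (M , w ⊨ χ) ⇔ (M , w' ⊨ χ)

Agree-sym : ∀ {M L w w'} → Agree M L w w' → Agree M L w' w
Agree-sym w≈w' χ∈L = ⇔.sym (w≈w' χ∈L)

Agree-trans : ∀ {M L w w' w''} → Agree M L w w' → Agree M L w' w'' → Agree M L w w''
Agree-trans w≈w' w'≈w'' χ∈L = ⇔.trans (w≈w' χ∈L) (w'≈w'' χ∈L)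

Forth : (M : Model) → List Form → W M → W M → Set
Forth M L w w' = ∀ {v} → R M w v → ∃[ v' ] R M w' v' × Agree M L v v'

Agree-by-successors : ∀ {M} θ {w w'} → (∀ {j} → Occurs j θ → V M j w ⇔ V M j w') →
                      Forth M (subs θ) w w' → Forth M (subs θ) w' w → Agree M (subs θ) w w'
Agree-by-successors {M} θ {w} {w'} atoms forth back χ∈θ = go _ (subs-⊆ θ χ∈θ)
  where
    go : ∀ χ → subs χ ⊆ subs θ → (M , w ⊨ χ) ⇔ (M , w' ⊨ χ)
    go (var j)    sub = atoms (var∈subs⇒Occurs θ (sub (here refl)))
    go ⊤f         _   = ⇔.refl
    go ⊥f         _   = ⇔.refl
    go (¬f χ)     sub = ¬-cong-⇔ (go χ (sub ∘ there))
    go (χ₁ ∧f χ₂) sub = go χ₁ (sub ∘ there ∘ ∈-++⁺ˡ) ×-⇔ go χ₂ (sub ∘ there ∘ ∈-++⁺ʳ (subs χ₁))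
    go (χ₁ ∨f χ₂) sub = go χ₁ (sub ∘ there ∘ ∈-++⁺ˡ) ⊎-⇔ go χ₂ (sub ∘ there ∘ ∈-++⁺ʳ (subs χ₁))
    go (◇ χ)      sub = mk⇔ (along forth) (along back)
      where
        along : ∀ {x x'} → Forth M (subs θ) x x' → M , x ⊨ (◇ χ) → M , x' ⊨ (◇ χ)
        along matched (v , xv , ⊨χ) =
          let v' , x'v' , v≈v' = matched xv in v' , x'v' , to (v≈v' (sub (there (subs-refl χ)))) ⊨χ
    go (□ χ)      sub = mk⇔ (along back) (along forth)
      where
        along : ∀ {x x'} → Forth M (subs θ) x' x → M , x ⊨ (□ χ) → M , x' ⊨ (□ χ)
        along matched ⊨□χ v' x'v' =
          let v , xv , v'≈v = matched x'v' in from (v'≈v (sub (there (subs-refl χ)))) (⊨□χ v xv)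

module _ (lem : ExcludedMiddle 0ℓ) (M : Model) (L : List Form) where

  truthTable : W M → Fin (length L) → Fin 2
  truthTable w j = decToBit (lem {M , w ⊨ lookup L j})

  truthTable-≗⇒Agree : ∀ {w w'} → truthTable w ≗ truthTable w' → Agree M L w w'
  truthTable-≗⇒Agree {w} {w'} same χ∈L =
    subst (λ ξ → (M , w ⊨ ξ) ⇔ (M , w' ⊨ ξ)) (sym (lookup-index χ∈L))
          (decToBit-≡⇒⇔ lem lem (same (index χ∈L)))

  separated⇒≤2^length : ∀ {m} (w : Fin m → W M) → (∀ {k k'} → Agree M L (w k) (w k') → k ≡ k') →
                        m ≤ 2 ^ length L
  separated⇒≤2^length w separated =
    injective⇒≤ {f = funToFin ∘ truthTable ∘ w} (separated ∘ truthTable-≗⇒Agree ∘ funToFin-injective)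

data Kind : Set where
  r p q : Kind

code : Kind → ℕ
code r = 0
code p = 1
code q = 2

letter : Kind → ℕ → ℕ
letter t i = i * 3 + code t

kind : ℕ → Kind
kind 0 = r
kind 1 = p
kind 2 = q
kind (suc (suc (suc j))) = kind j

kind-letter : ∀ t i → kind (letter t i) ≡ t
kind-letter r zero    = refl
kind-letter p zero    = refl
kind-letter q zero    = refl
kind-letter t (suc i) = kind-letter t i

letter-injective : ∀ {s t} i j → letter s i ≡ letter t j → s ≡ t × i ≡ j
letter-injective {s} {t} i j eq
  with trans (sym (kind-letter s i)) (trans (cong kind eq) (kind-letter t j))
... | refl = refl , *-cancelʳ-≡ i j 3 (+-cancelʳ-≡ (code s) (i * 3) (j * 3) eq)

atom : ∀ {n} → Kind → Fin n → Form
atom t i = var (letter t (toℕ i))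

matches : ℕ → Kind → Form
matches n t = ⋀ {n} λ i → atom r i ⇔f atom t i

rigidAll : ℕ → Kind → Form
rigidAll n t = ⋀ {n} λ i → rigid (atom t i)

fixes : ℕ → Kind → Form
fixes n t = matches n t ∧f rigidAll n t

Φ Ξ Ψ : ℕ → Form
Φ n = fixes n p ∧f (◇ ◇ matches n p)
Ξ n = fixes n q ∧f (□ □ (¬f matches n q))
Ψ n = ¬f Ξ n

len-matches : ∀ n t → len (matches n t) ≡ n * 18 + 1
len-matches n t = len-⋀ {n} 15 (λ i → atom r i ⇔f atom t i) λ _ → refl

len-rigidAll : ∀ n t → len (rigidAll n t) ≡ n * 22 + 1
len-rigidAll n t = len-⋀ {n} 19 (λ i → rigid (atom t i)) λ _ → refl

len-Φ : ∀ n → len (Φ n) ≡ 58 * n + 11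
len-Φ n rewrite len-matches n p | len-rigidAll n p = arith n
  where
    arith : ∀ n → 3 + (3 + (n * 18 + 1) + (n * 22 + 1)) + suc (suc (n * 18 + 1)) ≡ 58 * n + 11
    arith = solve-∀

len-Ψ : ∀ n → len (Ψ n) ≡ 58 * n + 13
len-Ψ n rewrite len-matches n q | len-rigidAll n q = arith n
  where
    arith : ∀ n → suc (3 + (3 + (n * 18 + 1) + (n * 22 + 1)) + suc (suc (suc (n * 18 + 1))))
                  ≡ 58 * n + 13
    arith = solve-∀

Occurs-atom : ∀ {n j} t (i : Fin n) → Occurs j (atom t i) → kind j ≡ t
Occurs-atom t i refl = kind-letter t (toℕ i)

Occurs-matches : ∀ {j} n t → Occurs j (matches n t) → kind j ≡ r ⊎ kind j ≡ t
Occurs-matches n t o with Occurs-⋀ {n} (λ i → atom r i ⇔f atom t i) o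
... | i , inj₁ (inj₁ o) = inj₁ (Occurs-atom r i o)
... | i , inj₁ (inj₂ o) = inj₂ (Occurs-atom t i o)
... | i , inj₂ (inj₁ o) = inj₂ (Occurs-atom t i o)
... | i , inj₂ (inj₂ o) = inj₁ (Occurs-atom r i o)

Occurs-fixes : ∀ {j} n t → Occurs j (fixes n t) → kind j ≡ r ⊎ kind j ≡ t
Occurs-fixes n t (inj₁ o) = Occurs-matches n t o
Occurs-fixes n t (inj₂ o) with Occurs-⋀ {n} (λ i → rigid (atom t i)) o
... | i , o = inj₂ (Occurs-atom t i (Occurs-rigid (atom t i) o))

Occurs-Φ : ∀ n {j} → Occurs j (Φ n) → kind j ≡ r ⊎ kind j ≡ p
Occurs-Φ n (inj₁ o) = Occurs-fixes n p o
Occurs-Φ n (inj₂ o) = Occurs-matches n p o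

Occurs-Ψ : ∀ n {j} → Occurs j (Ψ n) → kind j ≡ r ⊎ kind j ≡ q
Occurs-Ψ n (inj₁ o) = Occurs-fixes n q o
Occurs-Ψ n (inj₂ o) = Occurs-matches n q o

shared-letters-are-r : ∀ n {j} → Occurs j (Φ n) → Occurs j (Ψ n) → kind j ≡ r
shared-letters-are-r n oΦ oΨ with Occurs-Φ n oΦ | Occurs-Ψ n oΨ
... | inj₁ j-is-r | _           = j-is-r
... | _           | inj₁ j-is-r = j-is-r
... | inj₂ j-is-p | inj₂ j-is-q = contradiction (trans (sym j-is-p) j-is-q) λ ()

module Validity (lem : ExcludedMiddle 0ℓ) where

  ⊨matches : ∀ M w n t → (M , w ⊨ matches n t) ⇔ (∀ i → (M , w ⊨ atom r i) ⇔ (M , w ⊨ atom t i))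
  ⊨matches _ _ n _ = mk⇔ (λ ⊨m i → to (¬⊎×¬⊎⇔⇔ lem lem) (⊨⋀⁻ {m = n} _ ⊨m i))
                         (λ r⇔t → ⊨⋀⁺ _ λ i → from (¬⊎×¬⊎⇔⇔ lem lem) (r⇔t i))

  matches-transport : ∀ {M w u v n s t} → M , w ⊨ fixes n s → M , w ⊨ fixes n t →
                      R M w u → R M u v → M , v ⊨ matches n s → M , v ⊨ matches n t
  matches-transport {M} {w} {u} {v} {n} {s} {t} (ms , rs) (mt , rt) wu uv ⊨ms =
    from (⊨matches M v n t) λ i → begin
      M , v ⊨ atom r i ∼⟨ to (⊨matches M v n s) ⊨ms i ⟩
      M , v ⊨ atom s i ∼⟨ ⇔.sym (⊨rigid⁻ {M} (atom s i) (⊨⋀⁻ {m = n} _ rs i) wu uv) ⟩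
      M , w ⊨ atom s i ∼⟨ ⇔.sym (to (⊨matches M w n s) ms i) ⟩
      M , w ⊨ atom r i ∼⟨ to (⊨matches M w n t) mt i ⟩
      M , w ⊨ atom t i ∼⟨ ⊨rigid⁻ {M} (atom t i) (⊨⋀⁻ {m = n} _ rt i) wu uv ⟩
      M , v ⊨ atom t i ∎
    where open EquationalReasoning

  Φ⇒Ψ : ∀ n → ⊨ (Φ n ⇒f Ψ n)
  Φ⇒Ψ n M w = →⇒¬⊎ lem λ (fixes-p , u , wu , v , uv , ⊨mp) (fixes-q , □□¬mq) →
    □□¬mq u wu v uv (matches-transport {M} {n = n} {p} {q} fixes-p fixes-q wu uv ⊨mp)

-- A point c : Fin N codes the r-valuation Bit c, and k : Fin (2 ^ N) codes the set of points
-- {d ∣ Bit k d}. A world is a pair of a component b, which gives the values of the p- and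
-- q-letters, and a node, which gives the values of the r-letters.
module CounterModel (lem : ExcludedMiddle 0ℓ) (n : ℕ) where
  open Validity lem using (⊨matches)

  N : ℕ
  N = 2 ^ n

  data Node : Set where
    top  : Fin N → Fin (2 ^ N) → Node
    mid  : Fin (2 ^ N) → Node
    leaf : Fin N → Node

  data _⟶_ : Node → Node → Set where
    top⟶mid  : ∀ {c k} → top c k ⟶ mid k
    mid⟶leaf : ∀ {k d} → Bit k d → mid k ⟶ leaf d

  label : Node → Fin n → Set
  label (top c _) = Bit c
  label (mid _)   = λ _ → ⊥
  label (leaf d)  = Bit d

  World : Set
  World = Fin N × Node

  Holds : Kind → World → Fin n → Set
  Holds r (_ , x) = label x
  Holds _ (b , _) = Bit b

  U : Model
  U = record
    { W = World
    ; R = λ { (b , x) (b' , y) → b ≡ b' × x ⟶ y }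
    ; V = λ j w → ∃[ t ] ∃[ i ] j ≡ letter t (toℕ i) × Holds t w i
    }

  ⊨atom : ∀ {w} t i → (U , w ⊨ atom t i) ⇔ Holds t w i
  ⊨atom {w} t i = mk⇔ read (λ h → t , i , refl , h)
    where
      read : U , w ⊨ atom t i → Holds t w i
      read (t' , i' , eq , h) with letter-injective (toℕ i) (toℕ i') eq
      ... | refl , i≡i' with toℕ-injective i≡i'
      ... | refl = h

  U⊨matches : ∀ {w} t → (U , w ⊨ matches n t) ⇔ (∀ i → Holds r w i ⇔ Holds t w i)
  U⊨matches {w} t = ⇔.trans (⊨matches U w n t) (mk⇔
    (λ r⇔t i → ⇔.trans (⇔.sym (⊨atom r i)) (⇔.trans (r⇔t i) (⊨atom t i)))
    (λ r⇔t i → ⇔.trans (⊨atom r i) (⇔.trans (r⇔t i) (⇔.sym (⊨atom t i)))))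

  Holds-component : ∀ t → t ≢ r → ∀ {b x y i} → Holds t (b , x) i ⇔ Holds t (b , y) i
  Holds-component r t≢r = contradiction refl t≢r
  Holds-component p _   = ⇔.refl
  Holds-component q _   = ⇔.refl

  U⊨rigidAll : ∀ {b x} t → t ≢ r → U , (b , x) ⊨ rigidAll n t
  U⊨rigidAll t t≢r = ⊨⋀⁺ {U} {m = n} _ λ i → ⊨rigid⁺ {U} lem (atom t i) (constant i)
    where
      constant : ∀ i {w u v} → R U w u → R U u v → (U , w ⊨ atom t i) ⇔ (U , v ⊨ atom t i)
      constant i {_ , _} {_ , _} {_ , _} (refl , _) (refl , _) =
        ⇔.trans (⊨atom t i) (⇔.trans (Holds-component t t≢r) (⇔.sym (⊨atom t i)))

  Φ-at : ∀ {c k} → Bit k c → U , (c , top c k) ⊨ Φ n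
  Φ-at {c} {k} c∈k =
    (from (U⊨matches p) (λ _ → ⇔.refl) , U⊨rigidAll p λ ()) ,
    (c , mid k) , (refl , top⟶mid) , (c , leaf c) , (refl , mid⟶leaf c∈k) ,
    from (U⊨matches p) (λ _ → ⇔.refl)

  Ξ-at : ∀ {c k} → ¬ Bit k c → U , (c , top c k) ⊨ Ξ n
  Ξ-at {c} {k} c∉k = (from (U⊨matches q) (λ _ → ⇔.refl) , U⊨rigidAll q λ ()) , λ where
    (_ , _) (refl , top⟶mid) (_ , _) (refl , mid⟶leaf d∈k) d-matches →
      c∉k (subst (Bit k) (Bit-ext (to (U⊨matches q) d-matches)) d∈k)

  module OverRLetters {ϑ : Form} (ϑ-over-r : ∀ {j} → Occurs j ϑ → kind j ≡ r) where

    atoms-agree : ∀ {b c x y} → label x ≡ label y → ∀ {j} → Occurs j ϑ → V U j (b , x) ⇔ V U j (c , y)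
    atoms-agree x≡y {j} o = mk⇔ (move x≡y) (move (sym x≡y))
      where
        move : ∀ {b c x y} → label x ≡ label y → V U j (b , x) → V U j (c , y)
        move x≡y (t , i , refl , h) with trans (sym (kind-letter t (toℕ i))) (ϑ-over-r o)
        ... | refl = r , i , refl , subst (λ ℓ → ℓ i) x≡y h

    leaf-component-irrelevant : ∀ {b c d} → Agree U (subs ϑ) (b , leaf d) (c , leaf d)
    leaf-component-irrelevant =
      Agree-by-successors ϑ (atoms-agree refl) (λ { {_ , _} (_ , ()) }) (λ { {_ , _} (_ , ()) })

    mid-component-irrelevant : ∀ {b c k} → Agree U (subs ϑ) (b , mid k) (c , mid k)
    mid-component-irrelevant = Agree-by-successors ϑ (atoms-agree refl) forth forth
      where
        forth : ∀ {b c k} → Forth U (subs ϑ) (b , mid k) (c , mid k)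
        forth {c = c} {v = _ , leaf d} (refl , mid⟶leaf d∈k) =
          (c , leaf d) , (refl , mid⟶leaf d∈k) , leaf-component-irrelevant

    top-determined-by-mid : ∀ {c k k'} → Agree U (subs ϑ) (c , mid k) (c , mid k') →
                            Agree U (subs ϑ) (c , top c k) (c , top c k')
    top-determined-by-mid mid≈mid' =
      Agree-by-successors ϑ (atoms-agree refl) (forth mid≈mid') (forth (Agree-sym mid≈mid'))
      where
        forth : ∀ {c k k'} → Agree U (subs ϑ) (c , mid k) (c , mid k') →
                Forth U (subs ϑ) (c , top c k) (c , top c k')
        forth {c} {k' = k'} mid≈mid' {v = _ , _} (refl , top⟶mid) =
          (c , mid k') , (refl , top⟶mid) , mid≈mid'

  dagSize-bound : ∀ ϑ → Interpolant (Φ n) (Ψ n) ϑ → 2 ^ n ≤ dagSize ϑ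
  dagSize-bound ϑ (Φ⇒ϑ , ϑ⇒Ψ , shared) =
    ^-cancelˡ-≤ 2 (s≤s (s≤s z≤n))
      (separated⇒≤2^length lem U (deduplicate _≟f_ (subs ϑ)) (λ k → b₀ , mid k)
        (λ mid≈mid' → separated (mid≈mid' ∘ ∈-deduplicate⁺ _≟f_)))
    where
      ϑ-over-r : ∀ {j} → Occurs j ϑ → kind j ≡ r
      ϑ-over-r o = shared-letters-are-r n (proj₁ (shared _ o)) (proj₂ (shared _ o))

      open OverRLetters {ϑ} ϑ-over-r

      ϑ-at-top : ∀ {c k} → (U , (c , top c k) ⊨ ϑ) ⇔ Bit k c
      ϑ-at-top = mk⇔ (λ ⊨ϑ → decidable-stable lem λ c∉k → ¬⊎⇒→ (ϑ⇒Ψ U _) ⊨ϑ (Ξ-at c∉k))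
                     (λ c∈k → ¬⊎⇒→ (Φ⇒ϑ U _) (Φ-at c∈k))

      b₀ : Fin N
      b₀ = fromℕ< (m^n>0 2 n)

      separated : ∀ {k k'} → Agree U (subs ϑ) (b₀ , mid k) (b₀ , mid k') → k ≡ k'
      separated {k} {k'} mid≈mid' = Bit-ext λ c → begin
        Bit k c                ∼⟨ ⇔.sym ϑ-at-top ⟩
        U , (c , top c k) ⊨ ϑ  ∼⟨ top-determined-by-mid (in-component c) (subs-refl ϑ) ⟩
        U , (c , top c k') ⊨ ϑ ∼⟨ ϑ-at-top ⟩
        Bit k' c               ∎
        where
          in-component : ∀ c → Agree U (subs ϑ) (c , mid k) (c , mid k')
          in-component c =
            Agree-trans mid-component-irrelevant (Agree-trans mid≈mid' mid-component-irrelevant)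

          open EquationalReasoning

theorem52 : ExcludedMiddle 0ℓ →
    Σ (ℕ → Form) λ φ → Σ (ℕ → Form) λ ψ →
    (∀ n → 1 ≤ n → ⊨ (φ n ⇒f ψ n)) ×
    PolyBounded (λ n → len (φ n)) × PolyBounded (λ n → len (ψ n)) ×
    (∀ n → 1 ≤ n → (ϑ : Form) → Interpolant (φ n) (ψ n) ϑ → 2 ^ n ≤ dagSize ϑ)
theorem52 lem =
  Φ , Ψ ,
  (λ n _ → Validity.Φ⇒Ψ lem n) ,
  linear⇒PolyBounded 58 11 len-Φ ,
  linear⇒PolyBounded 58 13 len-Ψ ,
  (λ n _ → CounterModel.dagSize-bound lem n)
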